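{- Let $\vdash$ be a regular entailment relation for an ordered group $G$ and $x\in G$. Define the relation $\vdash_x$ on $\mathrm{P}_{\mathrm{fe}}^*(G)$ by $A\vdash_x B$ iff there is an integer $p\ge0$ such that $A,A+px\vdash B$. Then $\vdash_x$ is a regular entailment relation, and it is the finest equivariant entailment relation $\vdash'$ coarser than $\vdash$ such that $0\vdash' x$.
   Context: Groups are commutative; an ordered group is a commutative group with a partial order $\le_G$ compatible with addition. $\mathrm{P}_{\mathrm{fe}}^*(G)$ is the set of nonempty finite subsets of $G$; $a$ stands for $\{a\}$, $A,A'$ for $A\cup A'$, $y+A=\{y+a:a\in A\}$. An unbounded entailment relation on $G$ is a relation $\vdash$ on $\mathrm{P}_{\mathrm{fe}}^*(G)$ with $a\vdash a$; $A\vdash B\Rightarrow A,A'\vdash B,B'$; ($A\vdash B,c$ and $A,c\vdash B$) $\Rightarrow A\vdash B$. It is equivariant if moreover $a\le_G b\Rightarrow a\vdash b$ and $A\vdash B\Rightarrow y+A\vdash y+B$ for all $y\in G$; regular if equivariant and $y+a,z+b\vdash z+a,y+b$ for all $a,b,y,z\in G$. $\vdash_2$ is coarser than $\vdash_1$ if $A\vdash_1B$ implies $A\vdash_2B$. -}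

module Defs where

open import Level using (Level; _⊔_; suc)
open import Data.Nat using (ℕ)
open import Data.Product using (Σ; _×_; _,_)
open import Data.List using ([]; _∷_)
open import Data.List.NonEmpty using (List⁺; [_]; _∷_; toList; map) renaming (_⁺++⁺_ to _,,_)
open import Function.Bundles using (_⇔_)
open import Relation.Binary.Structures using (IsPartialOrder)
open import Algebra.Bundles using (AbelianGroup)
import Algebra.Definitions.RawMonoid as RM
import Data.List.Membership.Setoid as Mem

record OrderedGroup (c ℓ₁ ℓ₂ : Level) : Set (suc (c ⊔ ℓ₁ ⊔ ℓ₂)) where
  field
    abelianGroup : AbelianGroup c ℓ₁
  open AbelianGroup abelianGroup public
  field
    _≤_ : Carrier → Carrier → Set ℓ₂
    isPartialOrder : IsPartialOrder _≈_ _≤_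
    ≤-compat : ∀ {a b} (y : Carrier) → a ≤ b → (y ∙ a) ≤ (y ∙ b)

  open RM rawMonoid public using () renaming (_×_ to _·_)

module _ {c ℓ₁ ℓ₂ : Level} (G : OrderedGroup c ℓ₁ ℓ₂) where
  open OrderedGroup G

  -- Nonempty finite subsets of G, represented by nonempty lists, considered
  -- up to having the same elements (membership up to the group's equality ≈).
  Pfe : Set c
  Pfe = List⁺ Carrier

  _∈_ : Carrier → Pfe → Set (c ⊔ ℓ₁)
  z ∈ A = Mem._∈_ setoid z (toList A)

  _≋_ : Pfe → Pfe → Set (c ⊔ ℓ₁)
  A ≋ B = ∀ z → (z ∈ A) ⇔ (z ∈ B)

  ⟦_⟧ : Carrier → Pfe
  ⟦ a ⟧ = [ a ]

  _+ₛ_ : Carrier → Pfe → Pfe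
  y +ₛ A = map (y ∙_) A

  Rel : (r : Level) → Set (c ⊔ suc r)
  Rel r = Pfe → Pfe → Set r

  record IsUnboundedEntailment {r} (_⊢_ : Rel r) : Set (c ⊔ ℓ₁ ⊔ r) where
    field
      respects : ∀ {A A' B B'} → A ≋ A' → B ≋ B' → A ⊢ B → A' ⊢ B'
      refl⊢    : ∀ a → ⟦ a ⟧ ⊢ ⟦ a ⟧
      weaken   : ∀ {A B} A' B' → A ⊢ B → (A ,, A') ⊢ (B ,, B')
      cut      : ∀ {A B} c → A ⊢ (B ,, ⟦ c ⟧) → (A ,, ⟦ c ⟧) ⊢ B → A ⊢ B

  record IsEquivariant {r} (_⊢_ : Rel r) : Set (c ⊔ ℓ₁ ⊔ ℓ₂ ⊔ r) where
    field
      isEntailment : IsUnboundedEntailment _⊢_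
      order        : ∀ {a b} → a ≤ b → ⟦ a ⟧ ⊢ ⟦ b ⟧
      translate    : ∀ {A B} y → A ⊢ B → (y +ₛ A) ⊢ (y +ₛ B)

  record IsRegular {r} (_⊢_ : Rel r) : Set (c ⊔ ℓ₁ ⊔ ℓ₂ ⊔ r) where
    field
      isEquivariant : IsEquivariant _⊢_
      regular       : ∀ a b y z →
        ((y ∙ a) ∷ (z ∙ b) ∷ []) ⊢ ((z ∙ a) ∷ (y ∙ b) ∷ [])

  Coarser : ∀ {r₁ r₂} → Rel r₂ → Rel r₁ → Set (c ⊔ r₁ ⊔ r₂)
  Coarser _⊢₂_ _⊢₁_ = ∀ {A B} → A ⊢₁ B → A ⊢₂ B

  entailAt : ∀ {r} → Rel r → Carrier → Rel r
  entailAt _⊢_ x A B = Σ ℕ λ p → (A ,, ((p · x) +ₛ A)) ⊢ B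

module Submission where

-- In a regular relation the multiples of x are convex: ε , n·x ⊢ k·x for k ≤ n
-- (regularity gives ε , (k+2)·x ⊢ (k+1)·x , x, and cutting x against the translate of
-- the previous instance lowers the conclusion by one step).
-- Cut for ⊢ₓ: from witnesses p for A ⊢ₓ B , c and q for A , c ⊢ₓ B, work over
-- S = A , A+(p+q)x , A+px , A+qx. Translating the first sequent by qx and trading each
-- shifted conclusion y+d back for d with the regularity instance c , y+d ⊢ y+c , d gives
-- S , c ⊢ B , c+qx; together with S ⊢ B , c and S , c , c+qx ⊢ B two cuts yield S ⊢ B,
-- and convexity cuts away A+px and A+qx, leaving A , A+(p+q)x ⊢ B.
-- Minimality: an equivariant ⊢' with 0 ⊢' x proves 0 ⊢' px, hence A ⊢' a+px for every
-- a ∈ A, and these cut A+px away from A , A+px ⊢' B.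

open import Defs
open import Level using (Level; _⊔_)
open import Data.Product using (_×_; _,_; ∃)
open import Data.Sum using ([_,_])
open import Data.Nat as ℕ using (zero; suc; _≤′_; ≤′-reflexive; ≤′-step)
open import Data.Nat.Properties using (m≤m+n; m≤n+m; ≤⇒≤′)
open import Data.List using ([]; _∷_; _++_)
import Data.List.Properties as List
open import Data.List.NonEmpty using (toList) renaming (_⁺++⁺_ to _,,_)
open import Data.List.Relation.Unary.Any using (here; there)
import Data.List.Membership.Setoid as Membership
import Data.List.Membership.Setoid.Properties as Membershipₚ
import Data.List.Relation.Binary.Subset.Setoid as Subset
import Data.List.Relation.Binary.Subset.Setoid.Properties as Subsetₚ
open import Function using (flip; _∘_)
open import Function.Bundles using (Equivalence; mk⇔)
import Relation.Binary.PropositionalEquality as ≡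
import Algebra.Properties.Monoid.Mult as Mult

module _ {c ℓ₁ ℓ₂ : Level} (G : OrderedGroup c ℓ₁ ℓ₂) where
  open OrderedGroup G
  open Membership setoid using () renaming (_∈_ to _∈ₗ_)
  open Subset setoid using () renaming (_⊆_ to _⊆ₗ_)
  open Membershipₚ using (∈-resp-≈)
  open Mult monoid using (×-homo-+)

  private
    ⟪_⟫ : Carrier → Pfe G
    ⟪_⟫ = ⟦_⟧ G

    infixr 6 _⊕_
    _⊕_ : Carrier → Pfe G → Pfe G
    _⊕_ = _+ₛ_ G

    infix 4 _∈ₛ_
    _∈ₛ_ : Carrier → Pfe G → Set (c ⊔ ℓ₁)
    _∈ₛ_ = _∈_ G

  infix 4 _⊆_
  _⊆_ : Pfe G → Pfe G → Set (c ⊔ ℓ₁)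
  A ⊆ B = toList A ⊆ₗ toList B

  ⊆-refl : ∀ {A} → A ⊆ A
  ⊆-refl = Subsetₚ.⊆-refl setoid

  ⊆-trans : ∀ {A B C} → A ⊆ B → B ⊆ C → A ⊆ C
  ⊆-trans = Subsetₚ.⊆-trans setoid

  ⊆-∪ˡ : ∀ A B → A ⊆ (A ,, B)
  ⊆-∪ˡ A B = Subsetₚ.xs⊆xs++ys setoid (toList A) (toList B)

  ⊆-∪ʳ : ∀ A B → B ⊆ (A ,, B)
  ⊆-∪ʳ A B = Subsetₚ.xs⊆ys++xs setoid (toList B) (toList A)

  ∪-⊆ : ∀ {A B C} → A ⊆ C → B ⊆ C → (A ,, B) ⊆ C
  ∪-⊆ {A} A⊆C B⊆C = [ A⊆C , B⊆C ] ∘ Membershipₚ.∈-++⁻ setoid (toList A)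

  ∪-mono : ∀ {A A' B B'} → A ⊆ A' → B ⊆ B' → (A ,, B) ⊆ (A' ,, B')
  ∪-mono = Subsetₚ.++⁺ setoid

  ⊆⇒∪≋ : ∀ {A B} → A ⊆ B → _≋_ G (A ,, B) B
  ⊆⇒∪≋ {A} {B} A⊆B _ = mk⇔ (∪-⊆ A⊆B ⊆-refl) (⊆-∪ʳ A B)

  ≋⇒⊆ : ∀ {A B} → _≋_ G A B → A ⊆ B
  ≋⇒⊆ A≋B = Equivalence.to (A≋B _)

  ⟪⟫-⊆ : ∀ {a A} → a ∈ₛ A → ⟪ a ⟫ ⊆ A
  ⟪⟫-⊆ a∈A (here z≈a) = ∈-resp-≈ setoid (sym z≈a) a∈A

  pair-⊆ : ∀ {a b A} → a ∈ₛ A → b ∈ₛ A → (⟪ a ⟫ ,, ⟪ b ⟫) ⊆ A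
  pair-⊆ a∈A b∈A = ∪-⊆ (⟪⟫-⊆ a∈A) (⟪⟫-⊆ b∈A)

  ∈-⊕⁺ : ∀ y {a A} → a ∈ₛ A → y ∙ a ∈ₛ y ⊕ A
  ∈-⊕⁺ y = Membershipₚ.∈-map⁺ setoid setoid ∙-congˡ

  ∈-⊕⁻ : ∀ y {u} A → u ∈ₛ y ⊕ A → ∃ λ a → a ∈ₛ A × u ≈ y ∙ a
  ∈-⊕⁻ y A = Membershipₚ.∈-map⁻ setoid setoid

  ⊕-mono : ∀ y {A B} → A ⊆ B → y ⊕ A ⊆ y ⊕ B
  ⊕-mono y = Subsetₚ.map⁺ setoid setoid ∙-congˡ

  ⊕-∪ : ∀ y A B → y ⊕ (A ,, B) ⊆ (y ⊕ A ,, y ⊕ B)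
  ⊕-∪ y A B {u} = ≡.subst (u ∈ₗ_) (List.map-++ (y ∙_) (toList A) (toList B))

  ∈-⊕-⊕⁻ : ∀ y z {u} A → u ∈ₛ y ⊕ z ⊕ A → ∃ λ a → a ∈ₛ A × u ≈ (y ∙ z) ∙ a
  ∈-⊕-⊕⁻ y z A u∈ with ∈-⊕⁻ y (z ⊕ A) u∈
  ... | v , v∈ , u≈yv with ∈-⊕⁻ z A v∈
  ... | a , a∈A , v≈za = a , a∈A , trans u≈yv (trans (∙-congˡ v≈za) (sym (assoc y z a)))

  ⊕-⊕-⊆ : ∀ {y z w} A → y ∙ z ≈ w → y ⊕ z ⊕ A ⊆ w ⊕ A
  ⊕-⊕-⊆ {y} {z} {w} A yz≈w u∈ with ∈-⊕-⊕⁻ y z A u∈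
  ... | a , a∈A , u≈ = ∈-resp-≈ setoid (sym (trans u≈ (∙-congʳ yz≈w))) (∈-⊕⁺ w a∈A)

  ⊕-comm-⊆ : ∀ y z A → y ⊕ z ⊕ A ⊆ z ⊕ y ⊕ A
  ⊕-comm-⊆ y z A u∈ with ∈-⊕-⊕⁻ y z A u∈
  ... | a , a∈A , u≈ = ∈-resp-≈ setoid (sym (trans u≈ (trans (∙-congʳ (comm y z)) (assoc z y a))))
                                        (∈-⊕⁺ z (∈-⊕⁺ y a∈A))

  module _ {r} {_⊢_ : Rel G r} (E : IsUnboundedEntailment G _⊢_) where
    open IsUnboundedEntailment E

    ⊢-mono : ∀ {A A' B B'} → A ⊆ A' → B ⊆ B' → A ⊢ B → A' ⊢ B'
    ⊢-mono {A' = A'} {B' = B'} A⊆A' B⊆B' = respects (⊆⇒∪≋ A⊆A') (⊆⇒∪≋ B⊆B') ∘ weaken A' B'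

    cut-list : ∀ {A A' B} zs → (∀ {z} → z ∈ₗ zs → A ⊢ (B ,, ⟪ z ⟫)) →
               toList A' ⊆ₗ toList A ++ zs → A' ⊢ B → A ⊢ B
    cut-list {A} {A'} [] _ A'⊆A =
      ⊢-mono (≡.subst (toList A' ⊆ₗ_) (List.++-identityʳ (toList A)) A'⊆A) ⊆-refl
    cut-list {A} {A'} (z ∷ zs) cuts A'⊆Azzs A'⊢B =
      cut z (cuts (here refl))
        (cut-list zs (⊢-mono (⊆-∪ˡ A ⟪ z ⟫) ⊆-refl ∘ cuts ∘ there)
          (≡.subst (toList A' ⊆ₗ_) (≡.sym (List.++-assoc (toList A) (z ∷ []) zs)) A'⊆Azzs)
          A'⊢B)

    cut-setˡ : ∀ {A B} Z → (∀ {z} → z ∈ₛ Z → A ⊢ (B ,, ⟪ z ⟫)) → (A ,, Z) ⊢ B → A ⊢ B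
    cut-setˡ Z cuts = cut-list (toList Z) cuts ⊆-refl

    entailAt-coarser : ∀ x → Coarser G (entailAt G _⊢_ x) _⊢_
    entailAt-coarser x {A} A⊢B = 0 , ⊢-mono (⊆-∪ˡ A (0 · x ⊕ A)) ⊆-refl A⊢B

    entailAt-respects : ∀ x {A A' B B'} → _≋_ G A A' → _≋_ G B B' →
                        entailAt G _⊢_ x A B → entailAt G _⊢_ x A' B'
    entailAt-respects x A≋A' B≋B' (p , h) =
      p , ⊢-mono (∪-mono (≋⇒⊆ A≋A') (⊕-mono (p · x) (≋⇒⊆ A≋A'))) (≋⇒⊆ B≋B') h

    entailAt-weaken : ∀ x {A B} A' B' → entailAt G _⊢_ x A B →
                      entailAt G _⊢_ x (A ,, A') (B ,, B')
    entailAt-weaken x {A} {B} A' B' (p , h) =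
      p , ⊢-mono (∪-mono (⊆-∪ˡ A A') (⊕-mono (p · x) (⊆-∪ˡ A A'))) (⊆-∪ˡ B B') h

    ε-entailAt : ∀ x → entailAt G _⊢_ x ⟪ ε ⟫ ⟪ x ⟫
    ε-entailAt x = 1 , ⊢-mono (⟪⟫-⊆ (⊆-∪ʳ ⟪ ε ⟫ _ (here x≈[1·x]ε))) ⊆-refl (refl⊢ x)
      where
      x≈[1·x]ε : x ≈ (x ∙ ε) ∙ ε
      x≈[1·x]ε = sym (trans (identityʳ _) (identityʳ x))

  flip-isUnboundedEntailment : ∀ {r} {_⊢_ : Rel G r} →
    IsUnboundedEntailment G _⊢_ → IsUnboundedEntailment G (flip _⊢_)
  flip-isUnboundedEntailment E = record
    { respects = λ A≋A' B≋B' → respects B≋B' A≋A'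
    ; refl⊢    = refl⊢
    ; weaken   = λ A' B' → weaken B' A'
    ; cut      = λ c ⊢Bc c⊢B → cut c c⊢B ⊢Bc
    }
    where open IsUnboundedEntailment E

  cut-setʳ : ∀ {r} {_⊢_ : Rel G r} → IsUnboundedEntailment G _⊢_ →
             ∀ {A B} Z → (∀ {z} → z ∈ₛ Z → (A ,, ⟪ z ⟫) ⊢ B) → A ⊢ (B ,, Z) → A ⊢ B
  cut-setʳ E = cut-setˡ (flip-isUnboundedEntailment E)

  module _ {r} {_⊢_ : Rel G r} (Q : IsEquivariant G _⊢_) where
    open IsEquivariant Q
    open IsUnboundedEntailment isEntailment

    ε⊢multiple : ∀ {x} → ⟪ ε ⟫ ⊢ ⟪ x ⟫ → ∀ p → ⟪ ε ⟫ ⊢ ⟪ p · x ⟫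
    ε⊢multiple ε⊢x zero = refl⊢ ε
    ε⊢multiple {x} ε⊢x (suc p) =
      cut (p · x) (⊢-mono isEntailment ⊆-refl (⊆-∪ʳ ⟪ suc p · x ⟫ _) (ε⊢multiple ε⊢x p))
        (⊢-mono isEntailment (⟪⟫-⊆ (⊆-∪ʳ ⟪ ε ⟫ _ (here (identityʳ _)))) (⟪⟫-⊆ (here (comm _ _)))
          (translate (p · x) ε⊢x))

    entailAt-translate : ∀ x {A B} y → entailAt G _⊢_ x A B →
                         entailAt G _⊢_ x (y ⊕ A) (y ⊕ B)
    entailAt-translate x {A} y (p , h) =
      p , ⊢-mono isEntailment (⊆-trans (⊕-∪ y A (p · x ⊕ A)) (∪-mono ⊆-refl (⊕-comm-⊆ y (p · x) A)))
                 ⊆-refl (translate y h)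

    entailAt-finest : ∀ x {r₀} {_⊢₀_ : Rel G r₀} → Coarser G _⊢_ _⊢₀_ →
                      ⟪ ε ⟫ ⊢ ⟪ x ⟫ → Coarser G _⊢_ (entailAt G _⊢₀_ x)
    entailAt-finest x coarser ε⊢x {A} {B} (p , h) =
      cut-setˡ isEntailment (p · x ⊕ A) cutMultiple (coarser h)
      where
      cutMultiple : ∀ {z} → z ∈ₛ p · x ⊕ A → A ⊢ (B ,, ⟪ z ⟫)
      cutMultiple z∈ with ∈-⊕⁻ (p · x) A z∈
      ... | a , a∈A , z≈ = ⊢-mono isEntailment
        (⟪⟫-⊆ (∈-resp-≈ setoid (sym (identityʳ a)) a∈A))
        (⟪⟫-⊆ (⊆-∪ʳ B _ (here (trans (comm _ _) (sym z≈)))))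
        (translate a (ε⊢multiple ε⊢x p))

  module _ {r} {_⊢_ : Rel G r} (R : IsRegular G _⊢_) where
    open IsRegular R
    open IsEquivariant isEquivariant
    open IsUnboundedEntailment isEntailment

    shift : ∀ {Γ Δ c} y → Γ ⊢ (Δ ,, ⟪ c ⟫) → (y ⊕ Γ ,, ⟪ c ⟫) ⊢ (Δ ,, ⟪ y ∙ c ⟫)
    shift {Γ} {Δ} {c} y Γ⊢Δc =
      cut-setʳ isEntailment (y ⊕ Δ) exchange
        (⊢-mono isEntailment (⊆-∪ˡ (y ⊕ Γ) ⟪ c ⟫) rearrange (translate y Γ⊢Δc))
      where
      rearrange : y ⊕ (Δ ,, ⟪ c ⟫) ⊆ ((Δ ,, ⟪ y ∙ c ⟫) ,, y ⊕ Δ)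
      rearrange = ⊆-trans (⊕-∪ y Δ ⟪ c ⟫)
        (∪-⊆ (⊆-∪ʳ (Δ ,, ⟪ y ∙ c ⟫) (y ⊕ Δ)) (⊆-trans (⊆-∪ʳ Δ _) (⊆-∪ˡ _ (y ⊕ Δ))))
      exchange : ∀ {w} → w ∈ₛ y ⊕ Δ → ((y ⊕ Γ ,, ⟪ c ⟫) ,, ⟪ w ⟫) ⊢ (Δ ,, ⟪ y ∙ c ⟫)
      exchange w∈ with ∈-⊕⁻ y Δ w∈
      ... | d , d∈Δ , w≈yd = ⊢-mono isEntailment
        (pair-⊆ (⊆-∪ˡ _ ⟪ _ ⟫ (⊆-∪ʳ (y ⊕ Γ) ⟪ c ⟫ (here (identityˡ c))))
                (⊆-∪ʳ (y ⊕ Γ ,, ⟪ c ⟫) ⟪ _ ⟫ (here (sym w≈yd))))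
        (pair-⊆ (⊆-∪ʳ Δ ⟪ y ∙ c ⟫ (here refl))
                (⊆-∪ˡ Δ ⟪ y ∙ c ⟫ (∈-resp-≈ setoid (sym (identityˡ d)) d∈Δ)))
        (regular c d ε y)

    module _ (x : Carrier) where
      step-down : ∀ k → (⟪ ε ⟫ ,, ⟪ suc k · x ⟫) ⊢ ⟪ k · x ⟫
      step-down zero = ⊢-mono isEntailment (⊆-∪ˡ ⟪ ε ⟫ _) ⊆-refl (refl⊢ ε)
      step-down (suc k) = cut x
        (⊢-mono isEntailment
          (pair-⊆ (⊆-∪ˡ ⟪ ε ⟫ _ (here (identityˡ ε))) (⊆-∪ʳ ⟪ ε ⟫ _ (here (comm _ _))))
          (pair-⊆ (⊆-∪ˡ ⟪ suc k · x ⟫ _ (here (identityʳ _))) (⊆-∪ʳ ⟪ suc k · x ⟫ _ (here (identityˡ x))))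
          (regular ε x ε (suc k · x)))
        (⊢-mono isEntailment
          (pair-⊆ (⊆-∪ʳ (⟪ ε ⟫ ,, ⟪ suc (suc k) · x ⟫) ⟪ x ⟫ (here (identityʳ x)))
                  (⊆-∪ˡ (⟪ ε ⟫ ,, ⟪ suc (suc k) · x ⟫) ⟪ x ⟫ (⊆-∪ʳ ⟪ ε ⟫ _ (here refl))))
          ⊆-refl
          (translate x (step-down k)))

      between : ∀ {k m} → k ≤′ m → (⟪ ε ⟫ ,, ⟪ m · x ⟫) ⊢ ⟪ k · x ⟫
      between (≤′-reflexive ≡.refl) = ⊢-mono isEntailment (⊆-∪ʳ ⟪ ε ⟫ _) ⊆-refl (refl⊢ _)
      between (≤′-step {m} k≤m) = cut (m · x)
        (⊢-mono isEntailment ⊆-refl (⊆-∪ʳ ⟪ _ ⟫ ⟪ m · x ⟫) (step-down m))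
        (⊢-mono isEntailment
          (∪-mono (⊆-∪ˡ ⟪ ε ⟫ ⟪ suc m · x ⟫) (⊆-refl {⟪ m · x ⟫}))
          ⊆-refl (between k≤m))

      ∈-between : ∀ {k m A z} → k ℕ.≤ m → z ∈ₛ k · x ⊕ A → (A ,, m · x ⊕ A) ⊢ ⟪ z ⟫
      ∈-between {k} {m} {A} k≤m z∈ with ∈-⊕⁻ (k · x) A z∈
      ... | a , a∈A , z≈ = ⊢-mono isEntailment
        (pair-⊆ (⊆-∪ˡ A _ (∈-resp-≈ setoid (sym (identityʳ a)) a∈A))
                (⊆-∪ʳ A _ (∈-resp-≈ setoid (comm _ _) (∈-⊕⁺ (m · x) a∈A))))
        (⟪⟫-⊆ (here (trans (comm _ _) (sym z≈))))
        (translate a (between (≤⇒≤′ k≤m)))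

      collapse : ∀ {p q n A B} → p ℕ.≤ n → q ℕ.≤ n →
                 ((A ,, n · x ⊕ A) ,, (p · x ⊕ A ,, q · x ⊕ A)) ⊢ B → (A ,, n · x ⊕ A) ⊢ B
      collapse {p} {q} {A = A} {B} p≤n q≤n = cut-setˡ isEntailment (p · x ⊕ A ,, q · x ⊕ A)
        (⊢-mono isEntailment ⊆-refl (⊆-∪ʳ B _)
          ∘ [ ∈-between p≤n , ∈-between q≤n ] ∘ Membershipₚ.∈-++⁻ setoid (toList (p · x ⊕ A)))

      entailAt-cut : ∀ {A B} c → entailAt G _⊢_ x A (B ,, ⟪ c ⟫) →
                     entailAt G _⊢_ x (A ,, ⟪ c ⟫) B → entailAt G _⊢_ x A B
      entailAt-cut {A} {B} c (p , H₁) (q , H₂) =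
        p ℕ.+ q , collapse (m≤m+n p q) (m≤n+m q p) (cut c S⊢Bc (cut (q · x ∙ c) Sc⊢Bqc Scqc⊢B))
        where
        pA = p · x ⊕ A
        qA = q · x ⊕ A
        nA = (p ℕ.+ q) · x ⊕ A
        S = (A ,, nA) ,, (pA ,, qA)
        A⊆S : A ⊆ S
        A⊆S = ⊆-trans (⊆-∪ˡ A nA) (⊆-∪ˡ _ _)
        nA⊆S : nA ⊆ S
        nA⊆S = ⊆-trans (⊆-∪ʳ A nA) (⊆-∪ˡ _ _)
        pA⊆S : pA ⊆ S
        pA⊆S = ⊆-trans (⊆-∪ˡ pA qA) (⊆-∪ʳ (A ,, nA) _)
        qA⊆S : qA ⊆ S
        qA⊆S = ⊆-trans (⊆-∪ʳ pA qA) (⊆-∪ʳ (A ,, nA) _)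
        q·x⊕pA⊆nA : q · x ⊕ pA ⊆ nA
        q·x⊕pA⊆nA = ⊕-⊕-⊆ A (trans (comm _ _) (sym (×-homo-+ x p q)))

        S⊢Bc : S ⊢ (B ,, ⟪ c ⟫)
        S⊢Bc = ⊢-mono isEntailment (∪-⊆ A⊆S pA⊆S) ⊆-refl H₁
        Sc⊢Bqc : (S ,, ⟪ c ⟫) ⊢ (B ,, ⟪ q · x ∙ c ⟫)
        Sc⊢Bqc = ⊢-mono isEntailment
          (∪-mono (⊆-trans (⊕-∪ (q · x) A pA) (∪-⊆ qA⊆S (⊆-trans q·x⊕pA⊆nA nA⊆S))) ⊆-refl)
          ⊆-refl (shift (q · x) H₁)
        Scqc⊢B : ((S ,, ⟪ c ⟫) ,, ⟪ q · x ∙ c ⟫) ⊢ B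
        Scqc⊢B = ⊢-mono isEntailment
          (∪-⊆ (⊆-trans (∪-mono A⊆S ⊆-refl) (⊆-∪ˡ (S ,, ⟪ c ⟫) _))
               (⊆-trans (⊕-∪ (q · x) A ⟪ c ⟫) (∪-mono (⊆-trans qA⊆S (⊆-∪ˡ S ⟪ c ⟫)) ⊆-refl)))
          ⊆-refl H₂

      entailAt-isRegular : IsRegular G (entailAt G _⊢_ x)
      entailAt-isRegular = record
        { isEquivariant = record
          { isEntailment = record
            { respects = entailAt-respects isEntailment x
            ; refl⊢    = coarser ∘ refl⊢
            ; weaken   = entailAt-weaken isEntailment x
            ; cut      = entailAt-cut
            }
          ; order     = λ a≤b → coarser (order a≤b)
          ; translate = entailAt-translate isEquivariant x
          }
        ; regular = λ a b y z → coarser (regular a b y z)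
        }
        where coarser = entailAt-coarser isEntailment x

proposition2p10 : ∀ {c ℓ₁ ℓ₂ r r' : Level} (G : OrderedGroup c ℓ₁ ℓ₂)
    (_⊢_ : Rel G r) → IsRegular G _⊢_ → (x : OrderedGroup.Carrier G) →
    IsRegular G (entailAt G _⊢_ x)
    × Coarser G (entailAt G _⊢_ x) _⊢_
    × entailAt G _⊢_ x (⟦_⟧ G (OrderedGroup.ε G)) (⟦_⟧ G x)
    × (∀ (_⊢'_ : Rel G r') → IsEquivariant G _⊢'_ → Coarser G _⊢'_ _⊢_ →
         (⟦_⟧ G (OrderedGroup.ε G) ⊢' ⟦_⟧ G x) →
         Coarser G _⊢'_ (entailAt G _⊢_ x))
proposition2p10 G _⊢_ R x =
    entailAt-isRegular G R x
  , entailAt-coarser G E x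
  , ε-entailAt G E x
  , λ _ Q → entailAt-finest G Q x
  where E = IsEquivariant.isEntailment (IsRegular.isEquivariant R)
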